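{- Let $G=(V,E)$ be a dually chordal graph containing no clique of size four, and let $T=(V,E_t)$ be a spanning tree of $G$ such that for every edge $uv \in E$, every vertex $w \in P_T(u,v)$ satisfies $uw \in E$ and $vw \in E$. Then for every edge $uv \in E$ we have $|P_T[u,v]| \le 3$; equivalently, if $uv \in E$ and $uv \notin E_t$, then there is exactly one vertex $w$ with $uw, wv \in E_t$.
   Context: All graphs are finite, undirected, connected, without loops or multiple edges. A graph is dually chordal if it has a maximum neighbourhood ordering, i.e. an ordering $(v_1,\ldots,v_n)$ of its vertices such that each $v_i$ has a vertex $u \in N[v_i] \cap \{v_i,\ldots,v_n\}$ with $N[w] \cap \{v_i,\ldots,v_n\} \subseteq N[u] \cap \{v_i,\ldots,v_n\}$ for all $w \in N[v_i]\cap\{v_i,\ldots,v_n\}$ (closed neighbourhoods taken in $G[\{v_i,\ldots,v_n\}]$). For vertices $u,v$ and a tree $T$, $P_T(u,v)$ denotes the set of vertices on the path from $u$ to $v$ in $T$ excluding $u$ and $v$, and $P_T[u,v] := P_T(u,v) \cup \{u,v\}$. -}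

module Defs where

open import Data.Nat using (ℕ; _≤_)
open import Data.Fin using (Fin) renaming (_≤_ to _≤ꟳ_)
open import Data.List using (List; []; _∷_; length)
open import Data.List.Membership.Propositional using (_∈_)
open import Data.List.Relation.Unary.Unique.Propositional using (Unique)
open import Data.Product using (Σ; ∃; ∃-syntax; _×_; _,_)
open import Data.Sum using (_⊎_)
open import Data.Empty using (⊥)
open import Relation.Nullary using (¬_; Dec)
open import Relation.Binary.PropositionalEquality using (_≡_)
open import Function.Definitions using (Injective)

record Graph (n : ℕ) : Set₁ where
  field
    Adj   : Fin n → Fin n → Set
    adj?  : ∀ u v → Dec (Adj u v)
    sym   : ∀ {u v} → Adj u v → Adj v u
    irrefl : ∀ {u} → ¬ Adj u u
open Graph public

module _ {n : ℕ} where

  data Chain (R : Fin n → Fin n → Set) : Fin n → List (Fin n) → Fin n → Set where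
    single : ∀ {u} → Chain R u (u ∷ []) u
    step   : ∀ {u w xs v} → R u w → Chain R w xs v → Chain R u (u ∷ xs) v

  IsPath : (Fin n → Fin n → Set) → Fin n → List (Fin n) → Fin n → Set
  IsPath R u xs v = Chain R u xs v × Unique xs

  Connected : Graph n → Set
  Connected G = ∀ u v → ∃[ xs ] Chain (Adj G) u xs v

  -- A cycle: distinct vertices x₁ … x_k, k ≥ 3, consecutive adjacent and x_k adjacent x₁.
  Acyclic : Graph n → Set
  Acyclic G = ∀ u xs v → IsPath (Adj G) u xs v → 3 ≤ length xs → ¬ Adj G v u

  record IsSpanningTree (G T : Graph n) : Set where
    field
      subgraph  : ∀ {u v} → Adj T u v → Adj G u v
      connected : Connected T
      acyclic   : Acyclic T

  InN : Graph n → Fin n → Fin n → Set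
  InN G v x = x ≡ v ⊎ Adj G v x

  -- Maximum neighbourhood ordering, given by the position rank v of every vertex
  -- (v_i has rank i); {v_i,…,v_n} = { x | rank v_i ≤ rank x }.
  IsMaxNeighbourhoodOrdering : Graph n → (Fin n → Fin n) → Set
  IsMaxNeighbourhoodOrdering G rank =
    Injective _≡_ _≡_ rank ×
    (∀ v → ∃[ u ] (rank v ≤ꟳ rank u × InN G v u ×
       (∀ w → rank v ≤ꟳ rank w → InN G v w →
          ∀ x → rank v ≤ꟳ rank x → InN G w x → InN G u x)))

  DuallyChordal : Graph n → Set
  DuallyChordal G = ∃[ rank ] IsMaxNeighbourhoodOrdering G rank

  K4Free : Graph n → Set
  K4Free G = ¬ (∃[ a ] ∃[ b ] ∃[ c ] ∃[ d ]
    (Adj G a b × Adj G a c × Adj G a d × Adj G b c × Adj G b d × Adj G c d))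

  -- w ∈ P_T(u,v) given the (unique) T-path xs = P_T[u,v]
  Internal : Fin n → List (Fin n) → Fin n → Fin n → Set
  Internal u xs v w = w ∈ xs × ¬ w ≡ u × ¬ w ≡ v

-- An edge uv whose tree path u w₁ w₂ … v had four or more vertices would,
-- together with the bypass hypothesis, make u, w₁, w₂, v a clique of size
-- four; so P_T[u,v] has at most three vertices.  If uv is not a tree edge,
-- the tree path is therefore u w v, and a second common tree neighbour w′
-- would close the cycle u w v w′ in T.

module Submission where

open import Defs
open import Data.Nat using (ℕ; _≤_; s≤s; z≤n)
open import Data.Fin using (Fin; _≟_)
open import Data.List using (List; length; []; _∷_)
open import Data.List.Membership.Propositional using (_∈_)
open import Data.List.Relation.Unary.All as All using ([]; _∷_)
open import Data.List.Relation.Unary.All.Properties using (¬Any⇒All¬)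
open import Data.List.Relation.Unary.Any using (here; there)
open import Data.List.Relation.Unary.AllPairs using ([]; _∷_)
open import Data.List.Relation.Unary.Unique.Propositional using (Unique)
open import Data.Product using (_×_; ∃-syntax; _,_; proj₁; proj₂)
open import Data.Empty using (⊥-elim)
open import Relation.Nullary using (¬_; yes; no)
open import Relation.Binary.PropositionalEquality using (_≡_; _≢_; refl; ≢-sym)

module _ {n : ℕ} {R : Fin n → Fin n → Set} where
  open import Data.List.Membership.DecPropositional (_≟_ {n}) using (_∈?_)

  Chain⇒last∈ : ∀ {u xs v} → Chain R u xs v → v ∈ xs
  Chain⇒last∈ single     = here refl
  Chain⇒last∈ (step _ c) = there (Chain⇒last∈ c)

  IsPath-suffix : ∀ {w ys v} u → IsPath R w ys v → u ∈ ys → ∃[ zs ] IsPath R u zs v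
  IsPath-suffix u (single   , u!)        (here refl) = _ , single , u!
  IsPath-suffix u (step r c , u!)        (here refl) = _ , step r c , u!
  IsPath-suffix u (step r c , _ ∷ ys!)   (there u∈) = IsPath-suffix u (c , ys!) u∈

  -- Loop erasure: if u recurs on the erased tail, restart the path there.
  Chain⇒IsPath : ∀ {u xs v} → Chain R u xs v → ∃[ ys ] IsPath R u ys v
  Chain⇒IsPath single = _ , single , [] ∷ []
  Chain⇒IsPath {u} (step r c) with Chain⇒IsPath c
  ... | ys , p with u ∈? ys
  ...   | yes u∈ys = IsPath-suffix u p u∈ys
  ...   | no  u∉ys = _ , step r (proj₁ p) , ¬Any⇒All¬ ys u∉ys ∷ proj₂ p

  short-Chain⇒common-neighbour : ∀ {u xs v} → Chain R u xs v → length xs ≤ 3 →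
    u ≢ v → ¬ R u v → ∃[ w ] (R u w × R w v)
  short-Chain⇒common-neighbour single                         _ u≢v _   = ⊥-elim (u≢v refl)
  short-Chain⇒common-neighbour (step r single)                _ _   ¬uv = ⊥-elim (¬uv r)
  short-Chain⇒common-neighbour (step r₁ (step r₂ single))     _ _   _   = _ , r₁ , r₂
  short-Chain⇒common-neighbour (step _ (step _ (step _ single)))    (s≤s (s≤s (s≤s ())))
  short-Chain⇒common-neighbour (step _ (step _ (step _ (step _ _)))) (s≤s (s≤s (s≤s ())))

Adj⇒≢ : ∀ {n} (G : Graph n) {a b} → Adj G a b → a ≢ b
Adj⇒≢ G ab refl = irrefl G ab

module _ {n : ℕ} (G : Graph n) where

  bypassed-path-length≤3 : K4Free G → (T : Graph n) → (∀ {a b} → Adj T a b → Adj G a b) →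
    ∀ {u v xs} → Adj G u v → IsPath (Adj T) u xs v →
    (∀ w → Internal u xs v w → Adj G u w × Adj G v w) → length xs ≤ 3
  bypassed-path-length≤3 k4 T sub {u} uv
      (step {w = w₁} r₁ (step {w = w₂} r₂ (step _ c)) , u∉ ∷ w₁∉ ∷ w₂∉ ∷ _) bypass =
    ⊥-elim (k4 (u , w₁ , w₂ , _ , sub r₁ , uw₂ , uv , sub r₂ , sym G vw₁ , sym G vw₂))
    where
    v∈ = Chain⇒last∈ c
    w₁-internal = there (here refl) , ≢-sym (All.head u∉) , All.lookup w₁∉ (there v∈)
    w₂-internal = there (there (here refl)) , ≢-sym (All.lookup u∉ (there (here refl)))
                , All.lookup w₂∉ v∈
    vw₁ = proj₂ (bypass w₁ w₁-internal)
    uw₂ = proj₁ (bypass w₂ w₂-internal)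
    vw₂ = proj₂ (bypass w₂ w₂-internal)
  bypassed-path-length≤3 _ _ _ _ (single , _)                   _ = s≤s z≤n
  bypassed-path-length≤3 _ _ _ _ (step _ single , _)            _ = s≤s (s≤s z≤n)
  bypassed-path-length≤3 _ _ _ _ (step _ (step _ single) , _)   _ = s≤s (s≤s (s≤s z≤n))

  Acyclic⇒common-neighbour-unique : Acyclic G → ∀ {u v w w′} → u ≢ v →
    Adj G u w → Adj G w v → Adj G u w′ → Adj G w′ v → w′ ≡ w
  Acyclic⇒common-neighbour-unique acyclic {w = w} {w′} u≢v uw wv uw′ w′v with w′ ≟ w
  ... | yes w′≡w = w′≡w
  ... | no  w′≢w = ⊥-elim (acyclic _ _ _ (cycle , distinct) (s≤s (s≤s (s≤s z≤n))) (sym G uw′))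
    where
    cycle = step uw (step wv (step (sym G w′v) single))
    distinct = (Adj⇒≢ G uw ∷ u≢v ∷ Adj⇒≢ G uw′ ∷ [])
             ∷ (Adj⇒≢ G wv ∷ ≢-sym w′≢w ∷ [])
             ∷ (≢-sym (Adj⇒≢ G w′v) ∷ [])
             ∷ [] ∷ []

corollary2 : {n : ℕ} (G T : Graph n) →
    Connected G → DuallyChordal G → K4Free G → IsSpanningTree G T →
    (∀ u v → Adj G u v → ∀ xs → IsPath (Adj T) u xs v →
    ∀ w → Internal u xs v w → Adj G u w × Adj G v w) →
    (∀ u v → Adj G u v → ∀ xs → IsPath (Adj T) u xs v → length xs ≤ 3)
    × (∀ u v → Adj G u v → ¬ Adj T u v →
    ∃[ w ] ((Adj T u w × Adj T w v) ×
    (∀ w′ → Adj T u w′ → Adj T w′ v → w′ ≡ w)))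
corollary2 G T _ _ k4 tree bypass = length≤3 , unique-middle
  where
  open IsSpanningTree tree

  length≤3 : ∀ u v → Adj G u v → ∀ xs → IsPath (Adj T) u xs v → length xs ≤ 3
  length≤3 u v uv xs p = bypassed-path-length≤3 G k4 T subgraph uv p (bypass u v uv xs p)

  unique-middle : ∀ u v → Adj G u v → ¬ Adj T u v →
    ∃[ w ] ((Adj T u w × Adj T w v) × (∀ w′ → Adj T u w′ → Adj T w′ v → w′ ≡ w))
  unique-middle u v uv ¬tuv with Chain⇒IsPath (proj₂ (connected u v))
  ... | xs , p@(c , _) with short-Chain⇒common-neighbour c (length≤3 u v uv xs p) (Adj⇒≢ G uv) ¬tuv
  ...   | w , uw , wv = w , (uw , wv) , λ w′ uw′ w′v →
          Acyclic⇒common-neighbour-unique T acyclic (Adj⇒≢ G uv) uw wv uw′ w′v
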